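{- Let $P:\mathcal{C}^{op}\to\mathbf{InfSL}$ be an existential m-variational doctrine. Then $P$ satisfies the rule of unique choice if and only if every arrow of $\mathcal{C}$ which is both $P$-injective and $P$-surjective is an isomorphism.
   Context: A primary doctrine is a functor $P:\mathcal{C}^{op}\to\mathbf{InfSL}$, $\mathcal{C}$ with finite products, $\mathbf{InfSL}$ the category of inf-semilattices and meet-preserving maps; $P_f=P(f)$, $\top_A$ the top of $P(A)$. $P$ is elementary if for each $A$ there is $\delta_A\in P(A\times A)$ such that for every $X$ the map $\alpha\mapsto P_{\langle pr_1,pr_2\rangle}(\alpha)\wedge P_{\langle pr_2,pr_3\rangle}(\delta_A)$, $P(X\times A)\to P(X\times A\times A)$, is left adjoint to $P_{\langle pr_1,pr_2,pr_2\rangle}$. $P$ is existential if each $P_{pr}$ along a product projection has a left adjoint $\exists_{pr}$ satisfying Beck–Chevalley and Frobenius reciprocity; then every $P_f$ has a left adjoint $\exists_f$. $P$ has comprehensive diagonals if for $f,g:X\to A$: $f=g$ iff $\top_X=P_{\langle f,g\rangle}(\delta_A)$. Strong comprehension: for each $\alpha\in P(A)$ an arrow $\{\alpha\}:X\to A$ with $\top_X=P_{\{\alpha\}}(\alpha)$ through which every $f:Y\to A$ with $\top_Y\le P_f(\alpha)$ factors uniquely; it is full if $\alpha\le\beta$ iff $\top_X\le P_{\{\alpha\}}(\beta)$. $P$ is m-variational if elementary with comprehensive diagonals and full strong comprehension. An arrow $f:X\to A$ is $P$-injective if $P_{f\times f}(\delta_A)=\delta_X$ and $P$-surjective if $\exists_f(\top_X)=\top_A$.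 $F\in P(A\times B)$ is total if $\exists_{pr_1}(F)=\top_A$ and single-valued if $P_{\langle pr_1,pr_2\rangle}(F)\wedge P_{\langle pr_1,pr_3\rangle}(F)\le P_{\langle pr_2,pr_3\rangle}(\delta_B)$ in $P(A\times B\times B)$. $P$ satisfies the rule of unique choice if for every total and single-valued $F\in P(A\times B)$ there is $f:A\to B$ with $F=P_{f\times id_B}(\delta_B)$. -}

module Defs where

open import Level using (Level; _⊔_; suc)
open import Relation.Binary.PropositionalEquality using (_≡_)
open import Data.Product using (Σ; _×_; _,_)
open import Function.Bundles using (_⇔_)

record CartCat (o h : Level) : Set (Level.suc (o ⊔ h)) where
  infixr 9 _∘_
  infixr 5 _⊗_
  field
    Obj  : Set o
    Hom  : Obj → Obj → Set h
    id   : ∀ {A} → Hom A A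
    _∘_  : ∀ {A B C} → Hom B C → Hom A B → Hom A C
    idˡ  : ∀ {A B} (f : Hom A B) → id ∘ f ≡ f
    idʳ  : ∀ {A B} (f : Hom A B) → f ∘ id ≡ f
    assoc : ∀ {A B C D} (f : Hom C D) (g : Hom B C) (k : Hom A B) →
            (f ∘ g) ∘ k ≡ f ∘ (g ∘ k)
    𝟙    : Obj
    !    : ∀ {A} → Hom A 𝟙
    !-unique : ∀ {A} (f : Hom A 𝟙) → f ≡ !
    _⊗_  : Obj → Obj → Obj
    π₁   : ∀ {A B} → Hom (A ⊗ B) A
    π₂   : ∀ {A B} → Hom (A ⊗ B) B
    ⟨_,_⟩ : ∀ {X A B} → Hom X A → Hom X B → Hom X (A ⊗ B)
    π₁-⟨⟩ : ∀ {X A B} (f : Hom X A) (g : Hom X B) → π₁ ∘ ⟨ f , g ⟩ ≡ f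
    π₂-⟨⟩ : ∀ {X A B} (f : Hom X A) (g : Hom X B) → π₂ ∘ ⟨ f , g ⟩ ≡ g
    ⟨⟩-unique : ∀ {X A B} (f : Hom X A) (g : Hom X B) (k : Hom X (A ⊗ B)) →
                π₁ ∘ k ≡ f → π₂ ∘ k ≡ g → k ≡ ⟨ f , g ⟩

  _⊗₁_ : ∀ {A B C D} → Hom A C → Hom B D → Hom (A ⊗ B) (C ⊗ D)
  f ⊗₁ g = ⟨ f ∘ π₁ , g ∘ π₂ ⟩

  pr₁³ : ∀ {A B C} → Hom ((A ⊗ B) ⊗ C) A
  pr₁³ = π₁ ∘ π₁
  pr₂³ : ∀ {A B C} → Hom ((A ⊗ B) ⊗ C) B
  pr₂³ = π₂ ∘ π₁
  pr₃³ : ∀ {A B C} → Hom ((A ⊗ B) ⊗ C) C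
  pr₃³ = π₂

  IsIso : ∀ {A B} → Hom A B → Set h
  IsIso {A} {B} f = Σ (Hom B A) λ g → (g ∘ f ≡ id) × (f ∘ g ≡ id)

record InfSL (p l : Level) : Set (Level.suc (p ⊔ l)) where
  infix 4 _≤_
  infixr 7 _∧_
  field
    Carrier : Set p
    _≤_     : Carrier → Carrier → Set l
    ≤-refl  : ∀ {x} → x ≤ x
    ≤-trans : ∀ {x y z} → x ≤ y → y ≤ z → x ≤ z
    ≤-antisym : ∀ {x y} → x ≤ y → y ≤ x → x ≡ y
    ⊤       : Carrier
    ⊤-max   : ∀ {x} → x ≤ ⊤
    _∧_     : Carrier → Carrier → Carrier
    ∧-lb₁   : ∀ {x y} → x ∧ y ≤ x
    ∧-lb₂   : ∀ {x y} → x ∧ y ≤ y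
    ∧-glb   : ∀ {x y z} → z ≤ x → z ≤ y → z ≤ x ∧ y

record Doctrine {o h : Level} (C : CartCat o h) (p l : Level)
       : Set (o ⊔ h ⊔ Level.suc (p ⊔ l)) where
  open CartCat C
  field
    P₀ : Obj → InfSL p l
  Pr : Obj → Set p
  Pr A = InfSL.Carrier (P₀ A)
  field
    P₁ : ∀ {A B} → Hom A B → Pr B → Pr A
    P₁-∧ : ∀ {A B} (f : Hom A B) (α β : Pr B) →
           P₁ f (InfSL._∧_ (P₀ B) α β) ≡ InfSL._∧_ (P₀ A) (P₁ f α) (P₁ f β)
    P₁-⊤ : ∀ {A B} (f : Hom A B) → P₁ f (InfSL.⊤ (P₀ B)) ≡ InfSL.⊤ (P₀ A)
    P₁-id : ∀ {A} (α : Pr A) → P₁ (id {A}) α ≡ α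
    P₁-∘  : ∀ {A B C'} (g : Hom B C') (f : Hom A B) (α : Pr C') →
            P₁ (g ∘ f) α ≡ P₁ f (P₁ g α)

  ⊤[_] : (A : Obj) → Pr A
  ⊤[ A ] = InfSL.⊤ (P₀ A)

  meet : (A : Obj) → Pr A → Pr A → Pr A
  meet A = InfSL._∧_ (P₀ A)

  IsLeftAdjointOf : ∀ {X A} → Hom X A → (Pr X → Pr A) → Set (p ⊔ l)
  IsLeftAdjointOf {X} {A} f L =
    ∀ (α : Pr X) (β : Pr A) → (InfSL._≤_ (P₀ A) (L α) β) ⇔ (InfSL._≤_ (P₀ X) α (P₁ f β))

record Elementary {o h p l} {C : CartCat o h} (P : Doctrine C p l)
       : Set (o ⊔ h ⊔ p ⊔ l) where
  open CartCat C
  open Doctrine P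
  field
    δ : ∀ A → Pr (A ⊗ A)
    elem : ∀ {X A} (α : Pr (X ⊗ A)) (β : Pr ((X ⊗ A) ⊗ A)) →
      (InfSL._≤_ (P₀ ((X ⊗ A) ⊗ A))
         (meet ((X ⊗ A) ⊗ A) (P₁ ⟨ pr₁³ , pr₂³ ⟩ α) (P₁ ⟨ pr₂³ , pr₃³ ⟩ (δ A))) β)
      ⇔ (InfSL._≤_ (P₀ (X ⊗ A)) α (P₁ ⟨ ⟨ π₁ , π₂ ⟩ , π₂ ⟩ β))

record Existential {o h p l} {C : CartCat o h} (P : Doctrine C p l)
       : Set (o ⊔ h ⊔ p ⊔ l) where
  open CartCat C
  open Doctrine P
  field
    ∃₁ : ∀ {A B} → Pr (A ⊗ B) → Pr A
    ∃₁-adj : ∀ {A B} → IsLeftAdjointOf (π₁ {A} {B}) ∃₁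
    ∃₁-BC : ∀ {X A B} (f : Hom X A) (α : Pr (A ⊗ B)) →
            ∃₁ (P₁ (f ⊗₁ id {B}) α) ≡ P₁ f (∃₁ α)
    ∃₁-Frob : ∀ {A B} (β : Pr A) (α : Pr (A ⊗ B)) →
            ∃₁ (meet (A ⊗ B) (P₁ π₁ β) α) ≡ meet A β (∃₁ α)
    ∃₂ : ∀ {A B} → Pr (A ⊗ B) → Pr B
    ∃₂-adj : ∀ {A B} → IsLeftAdjointOf (π₂ {A} {B}) ∃₂
    ∃₂-BC : ∀ {X A B} (f : Hom X B) (α : Pr (A ⊗ B)) →
            ∃₂ (P₁ (id {A} ⊗₁ f) α) ≡ P₁ f (∃₂ α)
    ∃₂-Frob : ∀ {A B} (β : Pr B) (α : Pr (A ⊗ B)) →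
            ∃₂ (meet (A ⊗ B) (P₁ π₂ β) α) ≡ meet B β (∃₂ α)

record MVariational {o h p l} {C : CartCat o h} (P : Doctrine C p l)
       : Set (o ⊔ h ⊔ p ⊔ l) where
  open CartCat C
  open Doctrine P
  field
    elementary : Elementary P
  open Elementary elementary
  field
    comprehensive-diagonals : ∀ {X A} (f g : Hom X A) →
      (f ≡ g) ⇔ (⊤[ X ] ≡ P₁ ⟨ f , g ⟩ (δ A))
    Cmp : ∀ {A} → Pr A → Obj
    cmp : ∀ {A} (α : Pr A) → Hom (Cmp α) A
    cmp-⊤ : ∀ {A} (α : Pr A) → ⊤[ Cmp α ] ≡ P₁ (cmp α) α
    cmp-factor : ∀ {A Y} (α : Pr A) (f : Hom Y A) →
      InfSL._≤_ (P₀ Y) ⊤[ Y ] (P₁ f α) →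
      Σ (Hom Y (Cmp α)) λ k → (cmp α ∘ k ≡ f) ×
        (∀ (k' : Hom Y (Cmp α)) → cmp α ∘ k' ≡ f → k' ≡ k)
    cmp-full : ∀ {A} (α β : Pr A) →
      (InfSL._≤_ (P₀ A) α β) ⇔ (InfSL._≤_ (P₀ (Cmp α)) ⊤[ Cmp α ] (P₁ (cmp α) β))

module _ {o h p l} {C : CartCat o h} (P : Doctrine C p l) where
  open CartCat C
  open Doctrine P

  PInjective : Elementary P → ∀ {X A} → Hom X A → Set p
  PInjective E {X} {A} f = P₁ (f ⊗₁ f) (Elementary.δ E A) ≡ Elementary.δ E X

  -- P-surjective: ∃_f(⊤_X) = ⊤_A, where ∃_f is the left adjoint of P_f
  -- (unique when it exists, since P(X), P(A) are posets)
  PSurjective : ∀ {X A} → Hom X A → Set (p ⊔ l)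
  PSurjective {X} {A} f =
    Σ (Pr X → Pr A) λ L → IsLeftAdjointOf f L × (L ⊤[ X ] ≡ ⊤[ A ])

  Total : Existential P → ∀ {A B} → Pr (A ⊗ B) → Set p
  Total Ex {A} {B} F = Existential.∃₁ Ex F ≡ ⊤[ A ]

  SingleValued : Elementary P → ∀ {A B} → Pr (A ⊗ B) → Set l
  SingleValued E {A} {B} F =
    InfSL._≤_ (P₀ ((A ⊗ B) ⊗ B))
      (meet ((A ⊗ B) ⊗ B) (P₁ ⟨ pr₁³ , pr₂³ ⟩ F) (P₁ ⟨ pr₁³ , pr₃³ ⟩ F))
      (P₁ ⟨ pr₂³ , pr₃³ ⟩ (Elementary.δ E B))

  RuleOfUniqueChoice : Existential P → Elementary P → Set (o ⊔ h ⊔ p ⊔ l)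
  RuleOfUniqueChoice Ex E = ∀ {A B} (F : Pr (A ⊗ B)) →
    Total Ex F → SingleValued E F →
    Σ (Hom A B) λ f → F ≡ P₁ (f ⊗₁ id {B}) (Elementary.δ E B)

{-# OPTIONS --safe #-}
-- In an m-variational doctrine a predicate is determined by the generalized elements
-- c : Z → Y forcing it (full comprehension), and c forces δ exactly when its two components
-- coincide (comprehensive diagonals).  Read through generalized elements, the P-injective arrows
-- are the monos, and f : X → A is P-surjective iff its converse graph {(a, x) | a = f x} is total.
-- Given unique choice, the converse graph of a P-injective, P-surjective f is also single-valued,
-- hence the graph of some g, which is then inverse to f.  Conversely, for F total and
-- single-valued, the first projection of the comprehension {F} → A × B → A is P-injective and
-- P-surjective; composing its inverse with the second projection gives the arrow whose graph is F.
module Submission where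

open import Defs
open import Level using (_⊔_)
open import Data.Product using (_×_; _,_)
open import Function.Bundles using (_⇔_; mk⇔; Equivalence)
open import Function.Properties.Equivalence using () renaming (sym to ⇔-sym; trans to ⇔-trans)
open import Relation.Binary.PropositionalEquality

open Equivalence using (to; from)

≡-⇔ : ∀ {a} {A : Set a} {x x′ y y′ : A} → x ≡ x′ → y ≡ y′ → (x ≡ y) ⇔ (x′ ≡ y′)
≡-⇔ refl refl = mk⇔ (λ e → e) (λ e → e)

module Cartesian {o h} (C : CartCat o h) where
  open CartCat C

  Mono : ∀ {X A} → Hom X A → Set (o ⊔ h)
  Mono {X} f = ∀ {Z} (x y : Hom Z X) → f ∘ x ≡ f ∘ y → x ≡ y

  ⟨⟩-η : ∀ {Z A B} (c : Hom Z (A ⊗ B)) → ⟨ π₁ ∘ c , π₂ ∘ c ⟩ ≡ c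
  ⟨⟩-η c = sym (⟨⟩-unique _ _ c refl refl)

  ⟨⟩-ext : ∀ {Z A B} {c c′ : Hom Z (A ⊗ B)} → π₁ ∘ c ≡ π₁ ∘ c′ → π₂ ∘ c ≡ π₂ ∘ c′ → c ≡ c′
  ⟨⟩-ext {c′ = c′} e₁ e₂ = trans (⟨⟩-unique _ _ _ e₁ e₂) (⟨⟩-η c′)

  ∘π₁-⟨⟩ : ∀ {Z A B D} (u : Hom A D) (x : Hom Z A) (y : Hom Z B) → (u ∘ π₁) ∘ ⟨ x , y ⟩ ≡ u ∘ x
  ∘π₁-⟨⟩ u x y = trans (assoc u π₁ _) (cong (u ∘_) (π₁-⟨⟩ x y))

  π₁-⟨⟩∘ : ∀ {Z X A B} (u : Hom X A) (v : Hom X B) (c : Hom Z X) → π₁ ∘ (⟨ u , v ⟩ ∘ c) ≡ u ∘ c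
  π₁-⟨⟩∘ u v c = trans (sym (assoc π₁ ⟨ u , v ⟩ c)) (cong (_∘ c) (π₁-⟨⟩ u v))

  π₂-⟨⟩∘ : ∀ {Z X A B} (u : Hom X A) (v : Hom X B) (c : Hom Z X) → π₂ ∘ (⟨ u , v ⟩ ∘ c) ≡ v ∘ c
  π₂-⟨⟩∘ u v c = trans (sym (assoc π₂ ⟨ u , v ⟩ c)) (cong (_∘ c) (π₂-⟨⟩ u v))

  ⟨⟩∘ : ∀ {Z X A B} (u : Hom X A) (v : Hom X B) (c : Hom Z X) → ⟨ u , v ⟩ ∘ c ≡ ⟨ u ∘ c , v ∘ c ⟩
  ⟨⟩∘ u v c = ⟨⟩-unique (u ∘ c) (v ∘ c) _ (π₁-⟨⟩∘ u v c) (π₂-⟨⟩∘ u v c)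

module Forcing {o h p l} {C : CartCat o h} (P : Doctrine C p l) where
  open CartCat C
  open Doctrine P

  module _ {A : Obj} where
    open InfSL (P₀ A) public
      using (_≤_; _∧_; ≤-refl; ≤-trans; ≤-antisym; ⊤-max; ∧-lb₁; ∧-lb₂; ∧-glb)

  ∧-⊤ʳ : ∀ {A} (φ : Pr A) → φ ∧ ⊤[ A ] ≡ φ
  ∧-⊤ʳ φ = ≤-antisym ∧-lb₁ (∧-glb ≤-refl ⊤-max)

  P₁-mono : ∀ {X A} (f : Hom X A) {φ ψ : Pr A} → φ ≤ ψ → P₁ f φ ≤ P₁ f ψ
  P₁-mono f {φ} {ψ} φ≤ψ =
    subst (λ χ → P₁ f χ ≤ P₁ f ψ) φ∧ψ≡φ (subst (_≤ P₁ f ψ) (sym (P₁-∧ f φ ψ)) ∧-lb₂)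
    where
    φ∧ψ≡φ : φ ∧ ψ ≡ φ
    φ∧ψ≡φ = ≤-antisym ∧-lb₁ (∧-glb ≤-refl φ≤ψ)

  left-adjoint-unique : ∀ {X A} {f : Hom X A} {L L′ : Pr X → Pr A} →
    IsLeftAdjointOf f L → IsLeftAdjointOf f L′ → ∀ α → L α ≡ L′ α
  left-adjoint-unique L⊣ L′⊣ α =
    ≤-antisym (from (L⊣ α _) (to (L′⊣ α _) ≤-refl)) (from (L′⊣ α _) (to (L⊣ α _) ≤-refl))

  infix 4 _⊩_
  _⊩_ : ∀ {Z Y} → Hom Z Y → Pr Y → Set l
  _⊩_ {Z} c φ = ⊤[ Z ] ≤ P₁ c φ

  ⊩⇔≡⊤ : ∀ {Z Y} {c : Hom Z Y} {φ : Pr Y} → c ⊩ φ ⇔ (⊤[ Z ] ≡ P₁ c φ)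
  ⊩⇔≡⊤ = mk⇔ (λ c⊩φ → ≤-antisym c⊩φ ⊤-max) (λ e → subst (⊤[ _ ] ≤_) e ≤-refl)

  ⊩-P₁ : ∀ {Z Y W} {c : Hom Z Y} {f : Hom Y W} {φ : Pr W} → c ⊩ P₁ f φ ⇔ f ∘ c ⊩ φ
  ⊩-P₁ {c = c} {f} {φ} = mk⇔ (subst (⊤[ _ ] ≤_) (sym (P₁-∘ f c φ)))
                              (subst (⊤[ _ ] ≤_) (P₁-∘ f c φ))

  ⊩-mono : ∀ {Z Y} {c : Hom Z Y} {φ ψ : Pr Y} → φ ≤ ψ → c ⊩ φ → c ⊩ ψ
  ⊩-mono {c = c} φ≤ψ c⊩φ = ≤-trans c⊩φ (P₁-mono c φ≤ψ)

  ⊩-∘ : ∀ {V Z Y} {c : Hom Z Y} {φ : Pr Y} (d : Hom V Z) → c ⊩ φ → c ∘ d ⊩ φ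
  ⊩-∘ d c⊩φ = to ⊩-P₁ (subst (_≤ _) (P₁-⊤ d) (P₁-mono d c⊩φ))

  ⊩-⊤ : ∀ {Z Y} (c : Hom Z Y) → c ⊩ ⊤[ Y ]
  ⊩-⊤ c = subst (⊤[ _ ] ≤_) (sym (P₁-⊤ c)) ≤-refl

  ⊩-∧ : ∀ {Z Y} {c : Hom Z Y} {φ ψ : Pr Y} → c ⊩ φ → c ⊩ ψ → c ⊩ φ ∧ ψ
  ⊩-∧ {c = c} {φ} {ψ} c⊩φ c⊩ψ = subst (⊤[ _ ] ≤_) (sym (P₁-∧ c φ ψ)) (∧-glb c⊩φ c⊩ψ)

  ⊩-∧⁻ : ∀ {Z Y} {c : Hom Z Y} {φ ψ : Pr Y} → c ⊩ φ ∧ ψ → c ⊩ φ × c ⊩ ψ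
  ⊩-∧⁻ c⊩φ∧ψ = ⊩-mono ∧-lb₁ c⊩φ∧ψ , ⊩-mono ∧-lb₂ c⊩φ∧ψ

  SingleValuedOnPoints : ∀ {A B} → Pr (A ⊗ B) → Set (o ⊔ h ⊔ l)
  SingleValuedOnPoints {A} {B} F =
    ∀ {Z} (c c′ : Hom Z (A ⊗ B)) → c ⊩ F → c′ ⊩ F → π₁ ∘ c ≡ π₁ ∘ c′ → c ≡ c′

module Comprehension {o h p l} {C : CartCat o h} {P : Doctrine C p l} (M : MVariational P) where
  open CartCat C
  open Doctrine P
  open MVariational M
  open Elementary elementary
  open Cartesian C
  open Forcing P

  cmp-⊩ : ∀ {A} (α : Pr A) → cmp α ⊩ α
  cmp-⊩ α = from ⊩⇔≡⊤ (cmp-⊤ α)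

  cmp-mono : ∀ {A} (α : Pr A) → Mono (cmp α)
  cmp-mono α x y e with cmp-factor α (cmp α ∘ x) (⊩-∘ x (cmp-⊩ α))
  ... | _ , _ , unique = trans (unique x refl) (sym (unique y (sym e)))

  ≤-by-points : ∀ {Y} {γ β : Pr Y} → (∀ {Z} (c : Hom Z Y) → c ⊩ γ → c ⊩ β) → γ ≤ β
  ≤-by-points {γ = γ} {β} H = from (cmp-full γ β) (H (cmp γ) (cmp-⊩ γ))

  ≡-by-points : ∀ {Y} {γ β : Pr Y} → (∀ {Z} (c : Hom Z Y) → c ⊩ γ ⇔ c ⊩ β) → γ ≡ β
  ≡-by-points H = ≤-antisym (≤-by-points (λ c → to (H c))) (≤-by-points (λ c → from (H c)))

  ⊩-δ : ∀ {Z A} {c : Hom Z (A ⊗ A)} → c ⊩ δ A ⇔ (π₁ ∘ c ≡ π₂ ∘ c)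
  ⊩-δ {A = A} {c} = mk⇔
    (λ c⊩δ → from (comprehensive-diagonals _ _) (to ⊩⇔≡⊤ (subst (_⊩ δ A) (sym (⟨⟩-η c)) c⊩δ)))
    (λ e → subst (_⊩ δ A) (⟨⟩-η c) (from ⊩⇔≡⊤ (to (comprehensive-diagonals _ _) e)))

  ⊩-P₁⟨⟩δ : ∀ {Z X A} {u v : Hom X A} {c : Hom Z X} → c ⊩ P₁ ⟨ u , v ⟩ (δ A) ⇔ (u ∘ c ≡ v ∘ c)
  ⊩-P₁⟨⟩δ {u = u} {v} {c} = ⇔-trans ⊩-P₁ (⇔-trans ⊩-δ (≡-⇔ (π₁-⟨⟩∘ u v c) (π₂-⟨⟩∘ u v c)))

  ⊩-⊗₁δ : ∀ {Z X Y A} {u : Hom X A} {v : Hom Y A} {c : Hom Z (X ⊗ Y)} →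
    c ⊩ P₁ (u ⊗₁ v) (δ A) ⇔ (u ∘ (π₁ ∘ c) ≡ v ∘ (π₂ ∘ c))
  ⊩-⊗₁δ {u = u} {v} {c} = ⇔-trans ⊩-P₁⟨⟩δ (≡-⇔ (assoc u π₁ c) (assoc v π₂ c))

  graph : ∀ {A B} → Hom A B → Pr (A ⊗ B)
  graph {B = B} g = P₁ (g ⊗₁ id) (δ B)

  graphᵒ : ∀ {X A} → Hom X A → Pr (A ⊗ X)
  graphᵒ {A = A} f = P₁ (id ⊗₁ f) (δ A)

  ⊩-graph : ∀ {Z A B} {g : Hom A B} {c : Hom Z (A ⊗ B)} → c ⊩ graph g ⇔ (g ∘ (π₁ ∘ c) ≡ π₂ ∘ c)
  ⊩-graph = ⇔-trans ⊩-⊗₁δ (≡-⇔ refl (idˡ _))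

  ⊩-graphᵒ : ∀ {Z X A} {f : Hom X A} {c : Hom Z (A ⊗ X)} → c ⊩ graphᵒ f ⇔ (π₁ ∘ c ≡ f ∘ (π₂ ∘ c))
  ⊩-graphᵒ = ⇔-trans ⊩-⊗₁δ (≡-⇔ (idˡ _) refl)

  PInjective⇔Mono : ∀ {X A} {f : Hom X A} → PInjective P elementary f ⇔ Mono f
  PInjective⇔Mono {f = f} = mk⇔ injective⇒mono mono⇒injective
    where
    injective⇒mono : PInjective P elementary f → Mono f
    injective⇒mono inj x y fx≡fy = begin
      x                  ≡⟨ π₁-⟨⟩ x y ⟨
      π₁ ∘ ⟨ x , y ⟩     ≡⟨ to ⊩-δ (subst (⟨ x , y ⟩ ⊩_) inj (from ⊩-⊗₁δ f∘π₁≡f∘π₂)) ⟩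
      π₂ ∘ ⟨ x , y ⟩     ≡⟨ π₂-⟨⟩ x y ⟩
      y                  ∎
      where
      open ≡-Reasoning
      f∘π₁≡f∘π₂ : f ∘ (π₁ ∘ ⟨ x , y ⟩) ≡ f ∘ (π₂ ∘ ⟨ x , y ⟩)
      f∘π₁≡f∘π₂ = trans (cong (f ∘_) (π₁-⟨⟩ x y)) (trans fx≡fy (cong (f ∘_) (sym (π₂-⟨⟩ x y))))

    mono⇒injective : Mono f → PInjective P elementary f
    mono⇒injective mono = ≡-by-points λ c →
      ⇔-trans ⊩-⊗₁δ (⇔-trans (mk⇔ (mono _ _) (cong (f ∘_))) (⇔-sym ⊩-δ))

  SingleValued⇔OnPoints : ∀ {A B} {F : Pr (A ⊗ B)} →
    SingleValued P elementary F ⇔ SingleValuedOnPoints F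
  SingleValued⇔OnPoints {F = F} = mk⇔ on-points by-points
    where
    on-points : SingleValued P elementary F → SingleValuedOnPoints F
    on-points sv c c′ c⊩F c′⊩F π₁c≡π₁c′ = ⟨⟩-ext π₁c≡π₁c′ π₂c≡π₂c′
      where
      t = ⟨ c , π₂ ∘ c′ ⟩
      t₁₂ : ⟨ pr₁³ , pr₂³ ⟩ ∘ t ≡ c
      t₁₂ = trans (⟨⟩∘ _ _ t) (trans (cong₂ ⟨_,_⟩ (∘π₁-⟨⟩ π₁ _ _) (∘π₁-⟨⟩ π₂ _ _)) (⟨⟩-η c))
      t₁₃ : ⟨ pr₁³ , pr₃³ ⟩ ∘ t ≡ c′
      t₁₃ = trans (⟨⟩∘ _ _ t)
              (trans (cong₂ ⟨_,_⟩ (trans (∘π₁-⟨⟩ π₁ _ _) π₁c≡π₁c′) (π₂-⟨⟩ _ _)) (⟨⟩-η c′))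
      t⊩F∧F = ⊩-∧ (from ⊩-P₁ (subst (_⊩ F) (sym t₁₂) c⊩F))
                  (from ⊩-P₁ (subst (_⊩ F) (sym t₁₃) c′⊩F))
      π₂c≡π₂c′ : π₂ ∘ c ≡ π₂ ∘ c′
      π₂c≡π₂c′ = trans (sym (∘π₁-⟨⟩ π₂ c _)) (trans (to ⊩-P₁⟨⟩δ (⊩-mono sv t⊩F∧F)) (π₂-⟨⟩ _ _))

    by-points : SingleValuedOnPoints F → SingleValued P elementary F
    by-points sv = ≤-by-points λ t t⊩F∧F →
      let (t⊩F₁₂ , t⊩F₁₃) = ⊩-∧⁻ t⊩F∧F
          t₁₂≡t₁₃ = sv _ _ (to ⊩-P₁ t⊩F₁₂) (to ⊩-P₁ t⊩F₁₃)
                       (trans (π₁-⟨⟩∘ _ _ t) (sym (π₁-⟨⟩∘ _ _ t)))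
      in from ⊩-P₁⟨⟩δ
           (trans (sym (π₂-⟨⟩∘ _ _ t)) (trans (cong (π₂ ∘_) t₁₂≡t₁₃) (π₂-⟨⟩∘ _ _ t)))

module Images {o h p l} {C : CartCat o h} {P : Doctrine C p l}
  (Ex : Existential P) (M : MVariational P) where
  open CartCat C
  open Doctrine P
  open Existential Ex
  open Forcing P
  open Comprehension M

  ∃⟨_⟩ : ∀ {X A} → Hom X A → Pr X → Pr A
  ∃⟨ f ⟩ α = ∃₁ (graphᵒ f ∧ P₁ π₂ α)

  ⊩-∃₁ : ∀ {Z A B} {e : Hom Z (A ⊗ B)} {γ : Pr (A ⊗ B)} → e ⊩ γ → π₁ ∘ e ⊩ ∃₁ γ
  ⊩-∃₁ {γ = γ} e⊩γ = to ⊩-P₁ (⊩-mono (to (∃₁-adj γ (∃₁ γ)) ≤-refl) e⊩γ)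

  ⊩-∃⟨⟩ : ∀ {Z X A} {f : Hom X A} {α : Pr X} {c : Hom Z X} → c ⊩ α → f ∘ c ⊩ ∃⟨ f ⟩ α
  ⊩-∃⟨⟩ {f = f} {α} {c} c⊩α = subst (_⊩ ∃⟨ f ⟩ α) (π₁-⟨⟩ _ _) (⊩-∃₁ (⊩-∧ e⊩graphᵒ e⊩α))
    where
    e = ⟨ f ∘ c , c ⟩
    e⊩graphᵒ : e ⊩ graphᵒ f
    e⊩graphᵒ = from ⊩-graphᵒ (trans (π₁-⟨⟩ _ _) (cong (f ∘_) (sym (π₂-⟨⟩ _ _))))
    e⊩α : e ⊩ P₁ π₂ α
    e⊩α = from ⊩-P₁ (subst (_⊩ α) (sym (π₂-⟨⟩ _ _)) c⊩α)

  ∃⟨⟩-adj : ∀ {X A} (f : Hom X A) → IsLeftAdjointOf f ∃⟨ f ⟩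
  ∃⟨⟩-adj f α β = mk⇔ unit counit
    where
    unit : ∃⟨ f ⟩ α ≤ β → α ≤ P₁ f β
    unit ∃α≤β = ≤-by-points λ c c⊩α → from ⊩-P₁ (⊩-mono ∃α≤β (⊩-∃⟨⟩ c⊩α))

    counit : α ≤ P₁ f β → ∃⟨ f ⟩ α ≤ β
    counit α≤fβ = from (∃₁-adj _ β) (≤-by-points λ e e⊩graphᵒ∧α →
      let (e⊩graphᵒ , e⊩α) = ⊩-∧⁻ e⊩graphᵒ∧α
          fπ₂e⊩β = to ⊩-P₁ (⊩-mono α≤fβ (to ⊩-P₁ e⊩α))
      in from ⊩-P₁ (subst (_⊩ β) (sym (to ⊩-graphᵒ e⊩graphᵒ)) fπ₂e⊩β))

  ∃⟨⟩-⊤ : ∀ {X A} (f : Hom X A) → ∃⟨ f ⟩ ⊤[ X ] ≡ ∃₁ (graphᵒ f)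
  ∃⟨⟩-⊤ f = cong ∃₁ (trans (cong (graphᵒ f ∧_) (P₁-⊤ π₂)) (∧-⊤ʳ (graphᵒ f)))

  PSurjective⇔∃⟨⟩⊤≡⊤ : ∀ {X A} {f : Hom X A} → PSurjective P f ⇔ (∃⟨ f ⟩ ⊤[ X ] ≡ ⊤[ A ])
  PSurjective⇔∃⟨⟩⊤≡⊤ {X} {f = f} = mk⇔
    (λ (L , L-adj , L⊤≡⊤) → trans (left-adjoint-unique (∃⟨⟩-adj f) L-adj ⊤[ X ]) L⊤≡⊤)
    (λ ∃⊤≡⊤ → ∃⟨ f ⟩ , ∃⟨⟩-adj f , ∃⊤≡⊤)

module UniqueChoice {o h p l} {C : CartCat o h} {P : Doctrine C p l}
  (Ex : Existential P) (M : MVariational P) where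
  open CartCat C
  open Doctrine P
  open Existential Ex
  open MVariational M using (Cmp; cmp; cmp-factor)
  open Cartesian C
  open Forcing P
  open Comprehension M
  open Images Ex M

  graphᵒ-single-valued : ∀ {X A} {f : Hom X A} → Mono f → SingleValuedOnPoints (graphᵒ f)
  graphᵒ-single-valued mono c c′ c⊩ c′⊩ π₁c≡π₁c′ =
    ⟨⟩-ext π₁c≡π₁c′ (mono _ _ (trans (sym (to ⊩-graphᵒ c⊩)) (trans π₁c≡π₁c′ (to ⊩-graphᵒ c′⊩))))

  graphᵒ-total : ∀ {X A} {f : Hom X A} → PSurjective P f → Total P Ex (graphᵒ f)
  graphᵒ-total {f = f} surj = trans (sym (∃⟨⟩-⊤ f)) (to PSurjective⇔∃⟨⟩⊤≡⊤ surj)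

  graphᵒ≡graph⇒inverse : ∀ {X A} {f : Hom X A} {g : Hom A X} →
    graphᵒ f ≡ graph g → (g ∘ f ≡ id) × (f ∘ g ≡ id)
  graphᵒ≡graph⇒inverse {f = f} {g} graphᵒf≡graphg = g∘f≡id , f∘g≡id
    where
    g∘f≡id : g ∘ f ≡ id
    g∘f≡id = trans (cong (g ∘_) (sym (π₁-⟨⟩ f id)))
               (trans (to ⊩-graph (subst (⟨ f , id ⟩ ⊩_) graphᵒf≡graphg ⟨f,id⟩⊩graphᵒ)) (π₂-⟨⟩ f id))
      where
      ⟨f,id⟩⊩graphᵒ : ⟨ f , id ⟩ ⊩ graphᵒ f
      ⟨f,id⟩⊩graphᵒ = from ⊩-graphᵒ
        (trans (π₁-⟨⟩ f id) (sym (trans (cong (f ∘_) (π₂-⟨⟩ f id)) (idʳ f))))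

    f∘g≡id : f ∘ g ≡ id
    f∘g≡id = sym (trans (sym (π₁-⟨⟩ id g))
               (trans (to ⊩-graphᵒ (subst (⟨ id , g ⟩ ⊩_) (sym graphᵒf≡graphg) ⟨id,g⟩⊩graph))
                      (cong (f ∘_) (π₂-⟨⟩ id g))))
      where
      ⟨id,g⟩⊩graph : ⟨ id , g ⟩ ⊩ graph g
      ⟨id,g⟩⊩graph = from ⊩-graph
        (trans (cong (g ∘_) (π₁-⟨⟩ id g)) (trans (idʳ g) (sym (π₂-⟨⟩ id g))))

  module _ {A B} {F : Pr (A ⊗ B)} where
    π₁∘cmp-mono : SingleValuedOnPoints F → Mono (π₁ ∘ cmp F)
    π₁∘cmp-mono sv x y e = cmp-mono F x y
      (sv _ _ (⊩-∘ x (cmp-⊩ F)) (⊩-∘ y (cmp-⊩ F))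
          (trans (sym (assoc π₁ (cmp F) x)) (trans e (assoc π₁ (cmp F) y))))

    π₁∘cmp-surjective : Total P Ex F → PSurjective P (π₁ ∘ cmp F)
    π₁∘cmp-surjective total = from PSurjective⇔∃⟨⟩⊤≡⊤
      (≤-antisym ⊤-max (subst (_≤ image) total (from (∃₁-adj F image) (≤-by-points F≤image))))
      where
      image = ∃⟨ π₁ ∘ cmp F ⟩ ⊤[ Cmp F ]
      F≤image : ∀ {Z} (c : Hom Z (A ⊗ B)) → c ⊩ F → c ⊩ P₁ π₁ image
      F≤image c c⊩F with cmp-factor F c c⊩F
      ... | c′ , cmp∘c′≡c , _ = from ⊩-P₁ (subst (_⊩ image) π₁∘cmp∘c′≡π₁∘c (⊩-∃⟨⟩ (⊩-⊤ c′)))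
        where
        π₁∘cmp∘c′≡π₁∘c : (π₁ ∘ cmp F) ∘ c′ ≡ π₁ ∘ c
        π₁∘cmp∘c′≡π₁∘c = trans (assoc π₁ (cmp F) c′) (cong (π₁ ∘_) cmp∘c′≡c)

    ≡graph-of-section : SingleValuedOnPoints F → {s : Hom A (Cmp F)} → (π₁ ∘ cmp F) ∘ s ≡ id →
      F ≡ graph (π₂ ∘ (cmp F ∘ s))
    ≡graph-of-section sv {s} π₁∘cmp∘s≡id = ≡-by-points λ c →
      let a⊩F = subst (_⊩ F) (cmp∘s∘ (π₁ ∘ c)) (⊩-∘ (s ∘ (π₁ ∘ c)) (cmp-⊩ F))
      in ⇔-trans
        (mk⇔ (λ c⊩F → trans (sym (π₂-⟨⟩ _ _)) (cong (π₂ ∘_) (sv _ c a⊩F c⊩F (π₁-⟨⟩ _ _))))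
             (λ g∘π₁c≡π₂c → subst (_⊩ F) (trans (cong₂ ⟨_,_⟩ refl g∘π₁c≡π₂c) (⟨⟩-η c)) a⊩F))
        (⇔-sym ⊩-graph)
      where
      open ≡-Reasoning
      g = π₂ ∘ (cmp F ∘ s)
      cmp∘s∘ : ∀ {Z} (x : Hom Z A) → cmp F ∘ (s ∘ x) ≡ ⟨ x , g ∘ x ⟩
      cmp∘s∘ x = ⟨⟩-unique _ _ _
        (begin
          π₁ ∘ (cmp F ∘ (s ∘ x))   ≡⟨ assoc π₁ (cmp F) (s ∘ x) ⟨
          (π₁ ∘ cmp F) ∘ (s ∘ x)   ≡⟨ assoc (π₁ ∘ cmp F) s x ⟨
          ((π₁ ∘ cmp F) ∘ s) ∘ x   ≡⟨ cong (_∘ x) π₁∘cmp∘s≡id ⟩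
          id ∘ x                   ≡⟨ idˡ x ⟩
          x                        ∎)
        (begin
          π₂ ∘ (cmp F ∘ (s ∘ x))   ≡⟨ cong (π₂ ∘_) (assoc (cmp F) s x) ⟨
          π₂ ∘ ((cmp F ∘ s) ∘ x)   ≡⟨ assoc π₂ (cmp F ∘ s) x ⟨
          g ∘ x                    ∎)

proposition4p9 : ∀ {o h p l} (C : CartCat o h) (P : Doctrine C p l)
    (Ex : Existential P) (M : MVariational P) →
    RuleOfUniqueChoice P Ex (MVariational.elementary M)
    ⇔ (∀ {X A} (f : CartCat.Hom C X A) →
         PInjective P (MVariational.elementary M) f → PSurjective P f →
         CartCat.IsIso C f)
proposition4p9 C P Ex M = mk⇔ unique-choice⇒balanced balanced⇒unique-choice
  where
  open CartCat C
  open MVariational M using (elementary; cmp)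
  open Comprehension M
  open UniqueChoice Ex M

  unique-choice⇒balanced : RuleOfUniqueChoice P Ex elementary →
    ∀ {X A} (f : Hom X A) → PInjective P elementary f → PSurjective P f → IsIso f
  unique-choice⇒balanced unique-choice f injective surjective
    with unique-choice (graphᵒ f) (graphᵒ-total surjective)
           (from SingleValued⇔OnPoints (graphᵒ-single-valued (to PInjective⇔Mono injective)))
  ... | g , graphᵒf≡graphg = g , graphᵒ≡graph⇒inverse graphᵒf≡graphg

  balanced⇒unique-choice :
    (∀ {X A} (f : Hom X A) → PInjective P elementary f → PSurjective P f → IsIso f) →
    RuleOfUniqueChoice P Ex elementary
  balanced⇒unique-choice balanced F total single-valued
    with balanced (π₁ ∘ cmp F)
           (from PInjective⇔Mono (π₁∘cmp-mono (to SingleValued⇔OnPoints single-valued)))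
           (π₁∘cmp-surjective total)
  ... | s , _ , π₁∘cmp∘s≡id =
    _ , ≡graph-of-section (to SingleValued⇔OnPoints single-valued) π₁∘cmp∘s≡id
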